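{- Let $G$ be a finite group, $H$ a proper subgroup of $G$, $C$ an inverse-closed subset of $G\setminus\{1\}$, and $\Gamma=\mathrm{Cay}(G,H,C)$. The following are equivalent: (i) $\Gamma$ is a forest; (ii) $\Gamma$ is triangle-free and square-free, and the Cayley graph $\mathrm{Cay}\big(H,\,H\cap((C\cup C^2)\setminus\{1\})\big)$ is a forest; (iii) $H\cap C^2=\{1\}$ and either $H\cap C=\emptyset$ or $H\cap C=\{c\}$ for some involution $c$.
   Context: $C$ inverse-closed means $C^{ -1}\subseteq C$. The relative Cayley graph $\Gamma=\mathrm{Cay}(G,H,C)$ is the simple graph with vertex set $G$ in which two distinct vertices $x,y$ are adjacent if and only if at least one of $x,y$ lies in $H$ and $x^{ -1}y\in C$. $C^2=\{ab:a,b\in C\}$. For a group $K$ and inverse-closed $S\subseteq K\setminus\{1\}$, $\mathrm{Cay}(K,S)$ has vertex set $K$ with $x\sim y$ iff $x^{ -1}y\in S$. A graph is triangle-free (resp. square-free) if it has no induced subgraph isomorphic to the cycle $C_3$ (resp. $C_4$). -}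

module Defs where

open import Data.Bool using (Bool; T)
open import Data.Nat using (ℕ; _≤_)
open import Data.Fin using (Fin)
open import Data.List using (List; []; _∷_; _∷ʳ_; length)
open import Data.List.Relation.Unary.Linked using (Linked)
open import Data.List.Relation.Unary.Unique.Propositional using (Unique)
open import Data.Product using (Σ; _×_; _,_)
open import Data.Sum using (_⊎_)
open import Relation.Nullary using (¬_)
open import Relation.Binary.PropositionalEquality using (_≡_; _≢_)
open import Algebra.Core using (Op₁; Op₂)
open import Algebra.Structures using (IsGroup)
open import Function.Bundles using (_↔_)

record FiniteGroup : Set₁ where
  infixl 7 _∙_
  infix 8 _⁻¹
  field
    Carrier : Set
    _∙_     : Op₂ Carrier
    ε       : Carrier
    _⁻¹     : Op₁ Carrier
    isGroup : IsGroup _≡_ _∙_ ε _⁻¹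
    size    : ℕ
    enum    : Carrier ↔ Fin size

module _ {V : Set} (Adj : V → V → Set) where

  record Cycle : Set where
    field
      start    : V
      rest     : List V
      distinct : Unique (start ∷ rest)
      long     : 2 ≤ length rest
      closed   : Linked Adj ((start ∷ rest) ∷ʳ start)

  Forest : Set
  Forest = ¬ Cycle

  TriangleFree : Set
  TriangleFree = ∀ a b c → a ≢ b → b ≢ c → a ≢ c →
    ¬ (Adj a b × Adj b c × Adj c a)

  -- no induced subgraph isomorphic to C₄
  SquareFree : Set
  SquareFree = ∀ a b c d →
    a ≢ b → a ≢ c → a ≢ d → b ≢ c → b ≢ d → c ≢ d →
    ¬ (Adj a b × Adj b c × Adj c d × Adj d a × ¬ Adj a c × ¬ Adj b d)

module _ (G : FiniteGroup) where
  open FiniteGroup G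

  Subset : Set
  Subset = Carrier → Bool

  _∈_ : Carrier → Subset → Set
  x ∈ S = T (S x)

  record IsSubgroup (H : Subset) : Set where
    field
      ε-closed : ε ∈ H
      ∙-closed : ∀ {x y} → x ∈ H → y ∈ H → (x ∙ y) ∈ H
      ⁻¹-closed : ∀ {x} → x ∈ H → (x ⁻¹) ∈ H

  IsProper : Subset → Set
  IsProper H = Σ Carrier λ g → ¬ (g ∈ H)

  InverseClosed : Subset → Set
  InverseClosed C = ∀ x → x ∈ C → (x ⁻¹) ∈ C

  InSquare : Subset → Carrier → Set
  InSquare C x = Σ Carrier λ a → Σ Carrier λ b → a ∈ C × b ∈ C × x ≡ a ∙ b

  RelCayAdj : Subset → Subset → Carrier → Carrier → Set
  RelCayAdj H C x y = x ≢ y × (x ∈ H ⊎ y ∈ H) × ((x ⁻¹ ∙ y) ∈ C)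

  CayAdj : (H : Subset) → (S : Carrier → Set) →
    Σ Carrier (λ x → x ∈ H) → Σ Carrier (λ x → x ∈ H) → Set
  CayAdj H S (x , _) (y , _) = S (x ⁻¹ ∙ y)

  ConnII : Subset → Subset → Carrier → Set
  ConnII H C z = z ∈ H × (z ∈ C ⊎ InSquare C z) × z ≢ ε

  IsInvolution : Carrier → Set
  IsInvolution c = c ∙ c ≡ ε × c ≢ ε

-- If H ∩ C² = {1}, every vertex of a cycle in Γ is the middle of a non-backtracking path,
-- hence lies in H (otherwise both its neighbours are in H and differ by an element of
-- H ∩ C²); but two vertices of H at distance two again differ by an element of H ∩ C².
-- The same remark shows that Cay(H, H ∩ ((C ∪ C²) \ {1})) has no non-backtracking path
-- of length two.
-- Conversely, a nontrivial h = ab ∈ H ∩ C² yields a cycle in Γ: the powers of a or b when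
-- one of them lies in H and has order at least 3, and otherwise the closed walk
-- 1, a, h, ha, h², h²a, … of length 2·ord(h), whose vertices are distinct because a ∉ ⟨h⟩.
-- Under (ii) the long cycles are replaced, where possible, by a triangle or a square in Γ,
-- and otherwise by a cycle of powers of h or the triangle 1, a, h in Cay(H, …).
-- Finally H ∩ C² = {1} forces c² = 1 and c = c′ for all c, c′ ∈ H ∩ C.
module Submission where

open import Defs
open import Data.Bool.Properties using (T-irrelevant)
open import Data.Empty using (⊥; ⊥-elim)
open import Data.Fin using (toℕ)
open import Data.Fin.Properties using (pigeonhole; inj⇒≟)
import Data.Fin.Properties as Fin
open import Data.List using ([]; _∷_; _∷ʳ_; applyUpTo; map)
open import Data.List.Properties using (length-applyUpTo; applyUpTo-∷ʳ; length-map; map-++)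
open import Data.List.Relation.Unary.All using ([]; _∷_)
open import Data.List.Relation.Unary.AllPairs using ([]; _∷_)
open import Data.List.Relation.Unary.Linked using (Linked; [-]; _∷_)
import Data.List.Relation.Unary.Linked as Linked
import Data.List.Relation.Unary.Linked.Properties as Linked
import Data.List.Relation.Unary.Unique.Propositional.Properties as Unique
open import Data.Nat using (ℕ; zero; suc; _+_; _∸_; _≤_; _<_; s≤s; z≤n; _<?_)
open import Data.Nat.Induction using (<-rec)
open import Data.Nat.Properties
  using ( anyUpTo?; +-comm; +-suc; +-mono-≤; m∸n+n≡m; m<n⇒0<n∸m; m∸n≤m; ≤-pred; ≤-trans
        ; <⇒≤; <⇒≢; <⇒≱; ≰⇒>; <-trans; ≤-<-trans; <-cmp; n<1+n)
open import Data.Product using (Σ; ∃; _×_; _,_; proj₁; proj₂)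
open import Data.Sum using (_⊎_; inj₁; inj₂; [_,_])
open import Function using (_∘_)
open import Function.Bundles using (_⇔_; mk⇔; Inverse; Injection)
open import Function.Properties.Inverse using (↔⇒↣)
open import Algebra.Bundles using (Group)
import Algebra.Properties.Group as GroupProperties
import Algebra.Properties.Monoid.Mult as MonoidMult
open import Relation.Binary.Definitions using (tri<; tri≈; tri>)
open import Relation.Binary.PropositionalEquality
  using (_≡_; _≢_; ≢-sym; refl; sym; trans; cong; subst; module ≡-Reasoning)
open import Relation.Nullary using (¬_; Dec; yes; no; map′)
open import Relation.Nullary.Decidable using (_×-dec_; T?)
open import Relation.Unary using (Pred; Decidable)

module _ {V : Set} {Adj : V → V → Set} where

  cycle₃ : ∀ {a b c} → a ≢ b → a ≢ c → b ≢ c →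
    Adj a b → Adj b c → Adj c a → Cycle Adj
  cycle₃ a≢b a≢c b≢c ab bc ca = record
    { start = _ ; rest = _ ∷ _ ∷ []
    ; distinct = (a≢b ∷ a≢c ∷ []) ∷ (b≢c ∷ []) ∷ [] ∷ []
    ; long = s≤s (s≤s z≤n)
    ; closed = ab ∷ bc ∷ ca ∷ [-] }

  cycle₄ : ∀ {a b c d} → a ≢ b → a ≢ c → a ≢ d → b ≢ c → b ≢ d → c ≢ d →
    Adj a b → Adj b c → Adj c d → Adj d a → Cycle Adj
  cycle₄ a≢b a≢c a≢d b≢c b≢d c≢d ab bc cd da = record
    { start = _ ; rest = _ ∷ _ ∷ _ ∷ []
    ; distinct = (a≢b ∷ a≢c ∷ a≢d ∷ []) ∷ (b≢c ∷ b≢d ∷ []) ∷ (c≢d ∷ []) ∷ [] ∷ []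
    ; long = s≤s (s≤s z≤n)
    ; closed = ab ∷ bc ∷ cd ∷ da ∷ [-] }

  Forest⇒TriangleFree : Forest Adj → TriangleFree Adj
  Forest⇒TriangleFree F _ _ _ a≢b b≢c a≢c (ab , bc , ca) = F (cycle₃ a≢b a≢c b≢c ab bc ca)

  Forest⇒SquareFree : Forest Adj → SquareFree Adj
  Forest⇒SquareFree F _ _ _ _ a≢b a≢c a≢d b≢c b≢d c≢d (ab , bc , cd , da , _) =
    F (cycle₄ a≢b a≢c a≢d b≢c b≢d c≢d ab bc cd da)

  periodicCycle : (f : ℕ → V) (k : ℕ) → 3 ≤ k →
    (∀ {i j} → i < k → j < k → f i ≡ f j → i ≡ j) →
    (∀ i → Adj (f i) (f (suc i))) → f k ≡ f 0 → Cycle Adj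
  periodicCycle f (suc k) 3≤k injective adjacent fk≡f0 = record
    { start = f 0 ; rest = applyUpTo (f ∘ suc) k
    ; distinct = Unique.applyUpTo⁺₁ f (suc k)
        (λ i<j j<k fi≡fj → <⇒≢ i<j (injective (<-trans i<j j<k) j<k fi≡fj))
    ; long = subst (2 ≤_) (sym (length-applyUpTo (f ∘ suc) k)) (≤-pred 3≤k)
    ; closed = subst (Linked Adj)
        (trans (sym (applyUpTo-∷ʳ f (suc k))) (cong (applyUpTo f (suc k) ∷ʳ_) fk≡f0))
        (Linked.applyUpTo⁺₂ f (suc (suc k)) adjacent) }

  record NonBacktrackingWalk₄ : Set where
    field
      {v₀ v₁ v₂ v₃ v₄} : V
      v₀v₁ : Adj v₀ v₁
      v₁v₂ : Adj v₁ v₂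
      v₂v₃ : Adj v₂ v₃
      v₃v₄ : Adj v₃ v₄
      v₀≢v₂ : v₀ ≢ v₂
      v₁≢v₃ : v₁ ≢ v₃
      v₂≢v₄ : v₂ ≢ v₄

  Cycle⇒NonBacktrackingWalk₄ : Cycle Adj → NonBacktrackingWalk₄
  Cycle⇒NonBacktrackingWalk₄ record { rest = [] ; long = () }
  Cycle⇒NonBacktrackingWalk₄ record { rest = _ ∷ [] ; long = s≤s () }
  Cycle⇒NonBacktrackingWalk₄ record { rest = _ ∷ _ ∷ []
    ; distinct = (a≢b ∷ a≢c ∷ []) ∷ (b≢c ∷ []) ∷ _ ; closed = ab ∷ bc ∷ ca ∷ [-] } =
    record { v₀v₁ = ab ; v₁v₂ = bc ; v₂v₃ = ca ; v₃v₄ = ab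
           ; v₀≢v₂ = a≢c ; v₁≢v₃ = a≢b ∘ sym ; v₂≢v₄ = b≢c ∘ sym }
  Cycle⇒NonBacktrackingWalk₄ record { rest = _ ∷ _ ∷ _ ∷ []
    ; distinct = (_ ∷ a≢c ∷ _) ∷ (_ ∷ b≢d ∷ []) ∷ _ ; closed = ab ∷ bc ∷ cd ∷ da ∷ [-] } =
    record { v₀v₁ = ab ; v₁v₂ = bc ; v₂v₃ = cd ; v₃v₄ = da
           ; v₀≢v₂ = a≢c ; v₁≢v₃ = b≢d ; v₂≢v₄ = a≢c ∘ sym }
  Cycle⇒NonBacktrackingWalk₄ record { rest = _ ∷ _ ∷ _ ∷ _ ∷ _
    ; distinct = (_ ∷ a≢c ∷ _) ∷ (_ ∷ b≢d ∷ _) ∷ (_ ∷ c≢e ∷ _) ∷ _ ; closed = ab ∷ bc ∷ cd ∷ de ∷ _ } =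
    record { v₀v₁ = ab ; v₁v₂ = bc ; v₂v₃ = cd ; v₃v₄ = de
           ; v₀≢v₂ = a≢c ; v₁≢v₃ = b≢d ; v₂≢v₄ = c≢e }

  backtracking⇒Forest : (∀ {x y z} → Adj x y → Adj y z → x ≡ z) → Forest Adj
  backtracking⇒Forest backtrack cycle = v₀≢v₂ (backtrack v₀v₁ v₁v₂)
    where open NonBacktrackingWalk₄ (Cycle⇒NonBacktrackingWalk₄ cycle)

Cycle-map : ∀ {V W : Set} {A : V → V → Set} {B : W → W → Set} (f : V → W) →
  (∀ {x y} → f x ≡ f y → x ≡ y) → (∀ {x y} → A x y → B (f x) (f y)) → Cycle A → Cycle B
Cycle-map {B = B} f f-injective f-hom record
  { start = s ; rest = r ; distinct = distinct ; long = long ; closed = closed } = record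
  { start = f s ; rest = map f r
  ; distinct = Unique.map⁺ f-injective distinct
  ; long = subst (2 ≤_) (sym (length-map f r)) long
  ; closed = subst (Linked B) (map-++ f (s ∷ r) (s ∷ [])) (Linked.map⁺ (Linked.map f-hom closed)) }

least-witness : ∀ {p} {P : Pred ℕ p} → Decidable P → ∀ {n} → P n →
  ∃ λ m → P m × (∀ {k} → k < m → ¬ P k)
least-witness {P = P} P? = <-rec (λ n → P n → Least) search _
  where
  Least = ∃ λ m → P m × (∀ {k} → k < m → ¬ P k)
  search : ∀ n → (∀ {k} → k < n → P k → Least) → P n → Least
  search n below Pn with anyUpTo? P? n
  ... | yes (k , k<n , Pk) = below k<n Pk
  ... | no none = n , Pn , λ k<n Pk → none (_ , k<n , Pk)

data Parity : ℕ → Set where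
  even : ∀ i → Parity (i + i)
  odd  : ∀ i → Parity (suc (i + i))

parity : ∀ n → Parity n
parity zero = even zero
parity (suc n) with parity n
... | even i = odd i
... | odd i = subst Parity (cong suc (+-suc i i)) (even (suc i))

i+i<k+k⇒i<k : ∀ {i k} → i + i < k + k → i < k
i+i<k+k⇒i<k i+i<k+k = ≰⇒> (λ k≤i → <⇒≱ i+i<k+k (+-mono-≤ k≤i k≤i))

module FiniteGroupProperties (G : FiniteGroup) where
  open FiniteGroup G

  group : Group _ _
  group = record { isGroup = isGroup }

  open Group group public using (assoc; identityˡ; identityʳ; inverseˡ; _\\_)
  open GroupProperties group public
    using (ε⁻¹≈ε; ∙-cancelˡ; ∙-cancelʳ; \\-leftDividesˡ; \\-leftDividesʳ; inverseʳ-unique; ⁻¹-anti-homo-∙)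
  module Mult = MonoidMult (Group.monoid group)

  infix 4 _≟_
  _≟_ : (x y : Carrier) → Dec (x ≡ y)
  _≟_ = inj⇒≟ (↔⇒↣ enum)

  ∃? : {P : Carrier → Set} → (∀ x → Dec (P x)) → Dec (∃ P)
  ∃? {P} P? = map′ (λ (i , p) → from i , p) (λ (x , p) → to x , subst P (sym (strictlyInverseʳ x)) p)
    (Fin.any? (P? ∘ from))
    where open Inverse enum using (to; from; strictlyInverseʳ)

  infixr 8 _^_
  _^_ : Carrier → ℕ → Carrier
  g ^ n = n Mult.× g

  ^-sucʳ : ∀ g n → g ^ suc n ≡ g ^ n ∙ g
  ^-sucʳ g n = begin
    g ^ suc n      ≡⟨ cong (g ^_) (+-comm 1 n) ⟩
    g ^ (n + 1)    ≡⟨ Mult.×-homo-+ g n 1 ⟩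
    g ^ n ∙ g ^ 1  ≡⟨ cong (g ^ n ∙_) (identityʳ g) ⟩
    g ^ n ∙ g      ∎
    where open ≡-Reasoning

  ^-collision⇒^∸≡ε : ∀ g {i j} → i ≤ j → g ^ i ≡ g ^ j → g ^ (j ∸ i) ≡ ε
  ^-collision⇒^∸≡ε g {i} {j} i≤j gⁱ≡gʲ = ∙-cancelʳ (g ^ i) _ _ (begin
    g ^ (j ∸ i) ∙ g ^ i  ≡⟨ Mult.×-homo-+ g (j ∸ i) i ⟨
    g ^ (j ∸ i + i)      ≡⟨ cong (g ^_) (m∸n+n≡m i≤j) ⟩
    g ^ j                ≡⟨ gⁱ≡gʲ ⟨
    g ^ i                ≡⟨ identityˡ (g ^ i) ⟨
    ε ∙ g ^ i            ∎)
    where open ≡-Reasoning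

  ^-positiveExponent : ∀ g → ∃ λ n → 0 < n × g ^ n ≡ ε
  ^-positiveExponent g with pigeonhole (n<1+n size) (λ i → Inverse.to enum (g ^ toℕ i))
  ... | i , j , i<j , e =
    toℕ j ∸ toℕ i , m<n⇒0<n∸m i<j ,
    ^-collision⇒^∸≡ε g (<⇒≤ i<j) (Injection.injective (↔⇒↣ enum) e)

  record Order (g : Carrier) : Set where
    field
      order       : ℕ
      order>0     : 0 < order
      ^order≡ε    : g ^ order ≡ ε
      ^-injective : ∀ {i j} → i < order → j < order → g ^ i ≡ g ^ j → i ≡ j

  orderOf : ∀ g → Order g
  orderOf g with least-witness (λ n → (0 <? n) ×-dec (g ^ n ≟ ε)) (proj₂ (^-positiveExponent g))
  ... | k , (k>0 , gᵏ≡ε) , minimal = record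
    { order = k ; order>0 = k>0 ; ^order≡ε = gᵏ≡ε ; ^-injective = injective }
    where
    noCollision : ∀ {i j} → i < j → j < k → g ^ i ≢ g ^ j
    noCollision {i} {j} i<j j<k e =
      minimal (≤-<-trans (m∸n≤m j i) j<k) (m<n⇒0<n∸m i<j , ^-collision⇒^∸≡ε g (<⇒≤ i<j) e)
    injective : ∀ {i j} → i < k → j < k → g ^ i ≡ g ^ j → i ≡ j
    injective {i} {j} i<k j<k e with <-cmp i j
    ... | tri< i<j _ _ = ⊥-elim (noCollision i<j j<k e)
    ... | tri≈ _ i≡j _ = i≡j
    ... | tri> _ _ j<i = ⊥-elim (noCollision j<i i<k (sym e))

  ^≡ε⇒2≤ : ∀ {g n} → g ≢ ε → 0 < n → g ^ n ≡ ε → 2 ≤ n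
  ^≡ε⇒2≤ {g} {suc zero}    g≢ε _ g¹≡ε = ⊥-elim (g≢ε (trans (sym (identityʳ g)) g¹≡ε))
  ^≡ε⇒2≤ {n = suc (suc n)} _   _ _    = s≤s (s≤s z≤n)

  ^≡ε⇒3≤ : ∀ {g n} → g ≢ ε → g ∙ g ≢ ε → 0 < n → g ^ n ≡ ε → 3 ≤ n
  ^≡ε⇒3≤ {g} {suc (suc zero)}  _ g²≢ε _ g²≡ε =
    ⊥-elim (g²≢ε (trans (cong (g ∙_) (sym (identityʳ g))) g²≡ε))
  ^≡ε⇒3≤ {n = suc (suc (suc n))} _ _ _ _ = s≤s (s≤s (s≤s z≤n))
  ^≡ε⇒3≤ {n = suc zero} g≢ε _ 0<n g¹≡ε with s≤s () ← ^≡ε⇒2≤ g≢ε 0<n g¹≡ε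

  \\-trans : ∀ x y z → (x \\ y) ∙ (y \\ z) ≡ x \\ z
  \\-trans x y z = trans (assoc (x ⁻¹) y (y \\ z)) (cong (x ⁻¹ ∙_) (\\-leftDividesˡ y z))

  \\≡ε⇒≡ : ∀ {x y} → x \\ y ≡ ε → x ≡ y
  \\≡ε⇒≡ {x} {y} x\\y≡ε = trans (sym (identityʳ x)) (trans (cong (x ∙_) (sym x\\y≡ε)) (\\-leftDividesˡ x y))

  ∙-\\-∙ : ∀ h x y → (h ∙ x) \\ (h ∙ y) ≡ x \\ y
  ∙-\\-∙ h x y = begin
    (h ∙ x) ⁻¹ ∙ (h ∙ y)     ≡⟨ cong (_∙ (h ∙ y)) (⁻¹-anti-homo-∙ h x) ⟩
    (x ⁻¹ ∙ h ⁻¹) ∙ (h ∙ y)  ≡⟨ assoc (x ⁻¹) (h ⁻¹) (h ∙ y) ⟩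
    x ⁻¹ ∙ (h \\ (h ∙ y))    ≡⟨ cong (x ⁻¹ ∙_) (\\-leftDividesʳ h y) ⟩
    x \\ y                   ∎
    where open ≡-Reasoning

  ε\\ : ∀ x → ε \\ x ≡ x
  ε\\ x = trans (cong (_∙ x) ε⁻¹≈ε) (identityˡ x)

  -- h ^ i ≡ h ^ j ∙ a amounts to a ∈ ⟨h⟩ (by cancellation); this form avoids negative powers.
  _∉⟨_⟩ : Carrier → Carrier → Set
  a ∉⟨ h ⟩ = ∀ i j → h ^ i ≢ h ^ j ∙ a

  ∈⟨⟩⇒commute : ∀ {a h} i j → h ^ i ≡ h ^ j ∙ a → h ∙ a ≡ a ∙ h
  ∈⟨⟩⇒commute {a} {h} i j hⁱ≡hʲa = ∙-cancelˡ (h ^ j) _ _ (begin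
    h ^ j ∙ (h ∙ a)  ≡⟨ assoc (h ^ j) h a ⟨
    h ^ j ∙ h ∙ a    ≡⟨ cong (_∙ a) (^-sucʳ h j) ⟨
    h ∙ h ^ j ∙ a    ≡⟨ assoc h (h ^ j) a ⟩
    h ∙ (h ^ j ∙ a)  ≡⟨ cong (h ∙_) hⁱ≡hʲa ⟨
    h ^ suc i        ≡⟨ ^-sucʳ h i ⟩
    h ^ i ∙ h        ≡⟨ cong (_∙ h) hⁱ≡hʲa ⟩
    h ^ j ∙ a ∙ h    ≡⟨ assoc (h ^ j) a h ⟩
    h ^ j ∙ (a ∙ h)  ∎)
    where open ≡-Reasoning

  ^-involution : ∀ {h} → h ∙ h ≡ ε → ∀ n → h ^ n ≡ ε ⊎ h ^ n ≡ h
  ^-involution h²≡ε zero = inj₁ refl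
  ^-involution {h} h²≡ε (suc n) with ^-involution h²≡ε n
  ... | inj₁ hⁿ≡ε = inj₂ (trans (cong (h ∙_) hⁿ≡ε) (identityʳ h))
  ... | inj₂ hⁿ≡h = inj₁ (trans (cong (h ∙_) hⁿ≡h) h²≡ε)

  -- If a ∈ ⟨h⟩ for h = ab with a, b involutions, then ha = ah = b, so h² = b² = ε
  -- and ⟨h⟩ = {ε, h}; but neither a nor b lies in {ε, h}.
  involutions⇒∉⟨∙⟩ : ∀ {a b} → a ∙ a ≡ ε → b ∙ b ≡ ε → a ≢ ε → b ≢ ε → a ∉⟨ a ∙ b ⟩
  involutions⇒∉⟨∙⟩ {a} {b} a²≡ε b²≡ε a≢ε b≢ε i j hⁱ≡hʲa =
    [ (λ hʲa≡a → outside a≢ε a≢h (trans hⁱ≡hʲa hʲa≡a))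
    , (λ hʲa≡b → outside b≢ε b≢h (trans hⁱ≡hʲa hʲa≡b)) ] hʲa≡a⊎hʲa≡b
    where
    h = a ∙ b
    h∙a≡b : h ∙ a ≡ b
    h∙a≡b = begin
      h ∙ a        ≡⟨ ∈⟨⟩⇒commute i j hⁱ≡hʲa ⟩
      a ∙ (a ∙ b)  ≡⟨ assoc a a b ⟨
      (a ∙ a) ∙ b  ≡⟨ cong (_∙ b) a²≡ε ⟩
      ε ∙ b        ≡⟨ identityˡ b ⟩
      b            ∎
      where open ≡-Reasoning
    h²≡ε : h ∙ h ≡ ε
    h²≡ε = trans (sym (assoc h a b)) (trans (cong (_∙ b) h∙a≡b) b²≡ε)
    a≢h : a ≢ h
    a≢h a≡h = b≢ε (∙-cancelˡ a b ε (trans (sym a≡h) (sym (identityʳ a))))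
    b≢h : b ≢ h
    b≢h b≡h = a≢ε (∙-cancelʳ b a ε (trans (sym b≡h) (sym (identityˡ b))))
    outside : ∀ {x} → x ≢ ε → x ≢ h → h ^ i ≢ x
    outside x≢ε x≢h hⁱ≡x with ^-involution h²≡ε i
    ... | inj₁ hⁱ≡ε = x≢ε (trans (sym hⁱ≡x) hⁱ≡ε)
    ... | inj₂ hⁱ≡h = x≢h (trans (sym hⁱ≡x) hⁱ≡h)
    hʲa≡a⊎hʲa≡b : h ^ j ∙ a ≡ a ⊎ h ^ j ∙ a ≡ b
    hʲa≡a⊎hʲa≡b with ^-involution h²≡ε j
    ... | inj₁ hʲ≡ε = inj₁ (trans (cong (_∙ a) hʲ≡ε) (identityˡ a))
    ... | inj₂ hʲ≡h = inj₂ (trans (cong (_∙ a) hʲ≡h) h∙a≡b)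

module RelativeCayleyGraph (G : FiniteGroup) (H C : Subset G) (H≤G : IsSubgroup G H)
  (C⁻¹⊆C : InverseClosed G C) (ε∉C : ¬ _∈_ G (FiniteGroup.ε G) C) where
  open FiniteGroup G
  open FiniteGroupProperties G
  open IsSubgroup H≤G

  infix 4 _∈H _∈C
  _∈H _∈C : Carrier → Set
  x ∈H = _∈_ G x H
  x ∈C = _∈_ G x C

  Γ : Carrier → Carrier → Set
  Γ = RelCayAdj G H C

  Hᵥ : Set
  Hᵥ = Σ Carrier _∈H

  Γ[H] : Hᵥ → Hᵥ → Set
  Γ[H] = CayAdj G H (ConnII G H C)

  H∩C²-trivial : Set
  H∩C²-trivial = ∀ h → h ∈H → InSquare G C h → h ≡ ε

  H∩C-emptyOrInvolution : Set
  H∩C-emptyOrInvolution = (∀ x → ¬ (x ∈H × x ∈C))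
    ⊎ Σ Carrier (λ c → IsInvolution G c × (∀ x → (x ∈H × x ∈C) ⇔ (x ≡ c)))

  ∈C⇒≢ε : ∀ {x} → x ∈C → x ≢ ε
  ∈C⇒≢ε x∈C refl = ε∉C x∈C

  ∈H⇒≢∉H : ∀ {x y} → x ∈H → ¬ y ∈H → x ≢ y
  ∈H⇒≢∉H x∈H y∉H refl = y∉H x∈H

  \\-closed : ∀ {x y} → x ∈H → y ∈H → x \\ y ∈H
  \\-closed x∈H y∈H = ∙-closed (⁻¹-closed x∈H) y∈H

  ^-closed : ∀ {g} → g ∈H → ∀ n → g ^ n ∈H
  ^-closed g∈H zero = ε-closed
  ^-closed g∈H (suc n) = ∙-closed g∈H (^-closed g∈H n)

  Hᵥ-≡ : ∀ {u v : Hᵥ} → proj₁ u ≡ proj₁ v → u ≡ v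
  Hᵥ-≡ {x , x∈H} {.x , x∈H′} refl = cong (x ,_) (T-irrelevant x∈H x∈H′)

  Γ-intro : ∀ {x y} → x ∈H ⊎ y ∈H → x \\ y ∈C → Γ x y
  Γ-intro {x} x∈H⊎y∈H x\\y∈C = (λ { refl → ∈C⇒≢ε x\\y∈C (inverseˡ x) }) , x∈H⊎y∈H , x\\y∈C

  Γ-∉Hʳ : ∀ {x y} → Γ x y → ¬ y ∈H → x ∈H
  Γ-∉Hʳ (_ , inj₁ x∈H , _) _ = x∈H
  Γ-∉Hʳ (_ , inj₂ y∈H , _) y∉H = ⊥-elim (y∉H y∈H)

  Γ-∉Hˡ : ∀ {x y} → Γ x y → ¬ x ∈H → y ∈H
  Γ-∉Hˡ (_ , inj₁ x∈H , _) x∉H = ⊥-elim (x∉H x∈H)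
  Γ-∉Hˡ (_ , inj₂ y∈H , _) _ = y∈H

  Γ-translate : ∀ {h x y} → h ∈H → Γ x y → Γ (h ∙ x) (h ∙ y)
  Γ-translate {h} {x} {y} h∈H (x≢y , x∈H⊎y∈H , x\\y∈C) =
    (x≢y ∘ ∙-cancelˡ h x y) ,
    [ inj₁ ∘ ∙-closed h∈H , inj₂ ∘ ∙-closed h∈H ] x∈H⊎y∈H ,
    subst _∈C (sym (∙-\\-∙ h x y)) x\\y∈C

  Cay-powerCycle : ∀ (S : Carrier → Set) {g} → g ∈H → S g → g ≢ ε → g ∙ g ≢ ε →
    Cycle (CayAdj G H S)
  Cay-powerCycle S {g} g∈H Sg g≢ε g²≢ε =
    periodicCycle (λ j → g ^ j , ^-closed g∈H j) order (^≡ε⇒3≤ g≢ε g²≢ε order>0 ^order≡ε)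
      (λ i<k j<k e → ^-injective i<k j<k (cong proj₁ e))
      (λ j → subst S (sym (^-step j)) Sg) (Hᵥ-≡ ^order≡ε)
    where
    open Order (orderOf g)
    ^-step : ∀ j → g ^ j \\ g ^ suc j ≡ g
    ^-step j = trans (cong (g ^ j \\_) (^-sucʳ g j)) (\\-leftDividesʳ (g ^ j) g)

  Γ-powerCycle : ∀ {g} → g ∈H → g ∈C → g ∙ g ≢ ε → Cycle Γ
  Γ-powerCycle g∈H g∈C g²≢ε =
    Cycle-map proj₁ Hᵥ-≡ (λ {(_ , x∈H)} → Γ-intro (inj₁ x∈H))
      (Cay-powerCycle _∈C g∈H g∈C (∈C⇒≢ε g∈C) g²≢ε)

  module _ (trivial : H∩C²-trivial) where

    ∙∈H⇒≡ε : ∀ {a b} → a ∈C → b ∈C → a ∙ b ∈H → a ∙ b ≡ ε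
    ∙∈H⇒≡ε a∈C b∈C ab∈H = trivial _ ab∈H (_ , _ , a∈C , b∈C , refl)

    \\-∈C²⇒≡ : ∀ {x y z} → x \\ y ∈C → y \\ z ∈C → x \\ z ∈H → x ≡ z
    \\-∈C²⇒≡ {x} {y} {z} x\\y∈C y\\z∈C x\\z∈H = \\≡ε⇒≡ (trans (sym (\\-trans x y z))
      (∙∈H⇒≡ε x\\y∈C y\\z∈C (subst _∈H (sym (\\-trans x y z)) x\\z∈H)))

    Γ-middle∈H : ∀ {x y z} → Γ x y → Γ y z → x ≢ z → y ∈H
    Γ-middle∈H {y = y} xy@(_ , _ , x\\y∈C) yz@(_ , _ , y\\z∈C) x≢z with T? (H y)
    ... | yes y∈H = y∈H
    ... | no y∉H = ⊥-elim (x≢z (\\-∈C²⇒≡ x\\y∈C y\\z∈C (\\-closed (Γ-∉Hʳ xy y∉H) (Γ-∉Hˡ yz y∉H))))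

    H∩C²-trivial⇒Γ-forest : Forest Γ
    H∩C²-trivial⇒Γ-forest cycle = v₁≢v₃ (\\-∈C²⇒≡ (proj₂ (proj₂ v₁v₂)) (proj₂ (proj₂ v₂v₃))
        (\\-closed (Γ-middle∈H v₀v₁ v₁v₂ v₀≢v₂) (Γ-middle∈H v₂v₃ v₃v₄ v₂≢v₄)))
      where open NonBacktrackingWalk₄ (Cycle⇒NonBacktrackingWalk₄ cycle)

    connection∈C : ∀ {z} → ConnII G H C z → z ∈C
    connection∈C (_ , inj₁ z∈C , _) = z∈C
    connection∈C (z∈H , inj₂ z∈C² , z≢ε) = ⊥-elim (z≢ε (trivial _ z∈H z∈C²))

    H∩C²-trivial⇒Γ[H]-forest : Forest Γ[H]
    H∩C²-trivial⇒Γ[H]-forest = backtracking⇒Forest λ {(x , x∈H)} {_} {(z , z∈H)} xy yz →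
      Hᵥ-≡ (\\-∈C²⇒≡ (connection∈C xy) (connection∈C yz) (\\-closed x∈H z∈H))

    H∩C²-trivial⇒H∩C-emptyOrInvolution : H∩C-emptyOrInvolution
    H∩C²-trivial⇒H∩C-emptyOrInvolution with ∃? (λ x → T? (H x) ×-dec T? (C x))
    ... | no ∄ = inj₁ (λ x x∈H∩C → ∄ (x , x∈H∩C))
    ... | yes (c , c∈H , c∈C) = inj₂ (c , (c²≡ε , ∈C⇒≢ε c∈C) , λ x → mk⇔ unique λ { refl → c∈H , c∈C })
      where
      c²≡ε : c ∙ c ≡ ε
      c²≡ε = ∙∈H⇒≡ε c∈C c∈C (∙-closed c∈H c∈H)
      unique : ∀ {x} → x ∈H × x ∈C → x ≡ c
      unique {x} (x∈H , x∈C) = ∙-cancelʳ c x c (trans (∙∈H⇒≡ε x∈C c∈C (∙-closed x∈H c∈H)) (sym c²≡ε))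

  module NontrivialSquare {h a b} (h∈H : h ∈H) (a∈C : a ∈C) (b∈C : b ∈C)
    (h≡ab : h ≡ a ∙ b) (h≢ε : h ≢ ε) where

    a\\h≡b : a \\ h ≡ b
    a\\h≡b = trans (cong (a \\_) h≡ab) (\\-leftDividesʳ a b)

    a≢h : a ≢ h
    a≢h a≡h = ∈C⇒≢ε b∈C (trans (sym a\\h≡b) (trans (cong (a \\_) (sym a≡h)) (inverseˡ a)))

    ∈H⇒b∈H : a ∈H → b ∈H
    ∈H⇒b∈H a∈H = subst _∈H a\\h≡b (\\-closed a∈H h∈H)

    Γ-εa : Γ ε a
    Γ-εa = Γ-intro (inj₁ ε-closed) (subst _∈C (sym (ε\\ a)) a∈C)

    Γ-ah : Γ a h
    Γ-ah = Γ-intro (inj₂ h∈H) (subst _∈C (sym a\\h≡b) b∈C)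

    ∉H⇒∉⟨h⟩ : ¬ a ∈H → a ∉⟨ h ⟩
    ∉H⇒∉⟨h⟩ a∉H i j hⁱ≡hʲa =
      a∉H (subst _∈H (trans (cong (h ^ j \\_) hⁱ≡hʲa) (\\-leftDividesʳ (h ^ j) a))
                     (\\-closed (^-closed h∈H j) (^-closed h∈H i)))

    -- ε, a, h, h a, h², h² a, …: consecutive vertices differ by a or b, and every other one is in H.
    walk : ℕ → Carrier
    walk zero = ε
    walk (suc zero) = a
    walk (suc (suc n)) = h ∙ walk n

    walk-even : ∀ i → walk (i + i) ≡ h ^ i
    walk-even zero = refl
    walk-even (suc i) = trans (cong walk (cong suc (+-suc i i))) (cong (h ∙_) (walk-even i))

    walk-odd : ∀ i → walk (suc (i + i)) ≡ h ^ i ∙ a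
    walk-odd zero = sym (identityˡ a)
    walk-odd (suc i) = begin
      walk (suc (suc i + suc i))  ≡⟨ cong (walk ∘ suc) (+-suc (suc i) i) ⟩
      h ∙ walk (suc (i + i))      ≡⟨ cong (h ∙_) (walk-odd i) ⟩
      h ∙ (h ^ i ∙ a)             ≡⟨ assoc h (h ^ i) a ⟨
      h ^ suc i ∙ a               ∎
      where open ≡-Reasoning

    walk-adjacent : ∀ n → Γ (walk n) (walk (suc n))
    walk-adjacent zero = Γ-εa
    walk-adjacent (suc zero) = subst (Γ a) (sym (identityʳ h)) Γ-ah
    walk-adjacent (suc (suc n)) = Γ-translate h∈H (walk-adjacent n)

    module _ (a∉⟨h⟩ : a ∉⟨ h ⟩) where
      open Order (orderOf h)

      walk-injective : ∀ {m n} → m < order + order → n < order + order → walk m ≡ walk n → m ≡ n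
      walk-injective {m} {n} m<2k n<2k e with parity m | parity n
      ... | even i | even j = cong (λ t → t + t)
            (^-injective {i} {j} (i+i<k+k⇒i<k m<2k) (i+i<k+k⇒i<k n<2k)
              (trans (sym (walk-even i)) (trans e (walk-even j))))
      ... | odd i | odd j = cong (λ t → suc (t + t))
            (^-injective {i} {j} (i+i<k+k⇒i<k (<⇒≤ m<2k)) (i+i<k+k⇒i<k (<⇒≤ n<2k))
              (∙-cancelʳ a _ _ (trans (sym (walk-odd i)) (trans e (walk-odd j)))))
      ... | even i | odd j = ⊥-elim (a∉⟨h⟩ i j (trans (sym (walk-even i)) (trans e (walk-odd j))))
      ... | odd i | even j = ⊥-elim (a∉⟨h⟩ j i (trans (sym (walk-even j)) (trans (sym e) (walk-odd i))))

      dihedralCycle : Cycle Γ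
      dihedralCycle = periodicCycle walk (order + order)
        (≤-trans (s≤s (s≤s (s≤s z≤n))) (+-mono-≤ 2≤k 2≤k)) walk-injective walk-adjacent
        (trans (walk-even order) ^order≡ε)
        where
        2≤k : 2 ≤ order
        2≤k = ^≡ε⇒2≤ h≢ε order>0 ^order≡ε

    Γ-triangle : ¬ a ∈H → h ∈C → ¬ TriangleFree Γ
    Γ-triangle a∉H h∈C triangleFree = triangleFree ε a h
      (≢-sym (∈C⇒≢ε a∈C)) a≢h (≢-sym h≢ε)
      (Γ-εa , Γ-ah , Γ-intro (inj₁ h∈H) (subst _∈C (sym (identityʳ (h ⁻¹))) (C⁻¹⊆C h h∈C)))

    Γ-square : ¬ a ∈H → ¬ h ∈C → h ∙ h ≡ ε → ¬ SquareFree Γ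
    Γ-square a∉H h∉C h²≡ε squareFree = squareFree ε a h (h ∙ a)
      (≢-sym (∈C⇒≢ε a∈C)) (≢-sym h≢ε) (∈H⇒≢∉H ε-closed ha∉H) a≢h
      (λ a≡ha → h≢ε (sym (∙-cancelʳ a ε h (trans (identityˡ a) a≡ha))))
      (λ h≡ha → ∈C⇒≢ε a∈C (sym (∙-cancelˡ h ε a (trans (identityʳ h) h≡ha))))
      (Γ-εa , Γ-ah , Γ-intro (inj₁ h∈H) (subst _∈C (sym (\\-leftDividesʳ h a)) a∈C) ,
       Γ-intro (inj₂ ε-closed) (subst _∈C ha\\ε≡b b∈C) ,
       (λ (_ , _ , ε\\h∈C) → h∉C (subst _∈C (ε\\ h) ε\\h∈C)) ,
       (λ (_ , a∈H⊎ha∈H , _) → [ a∉H , ha∉H ] a∈H⊎ha∈H))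
      where
      ha∉H : ¬ h ∙ a ∈H
      ha∉H ha∈H = a∉H (subst _∈H (\\-leftDividesʳ h a) (\\-closed h∈H ha∈H))
      ha\\ε≡b : b ≡ (h ∙ a) \\ ε
      ha\\ε≡b = trans (inverseʳ-unique (h ∙ a) b
        (trans (assoc h a b) (trans (cong (h ∙_) (sym h≡ab)) h²≡ε))) (sym (identityʳ _))

    Γ[H]-triangle : a ∈H → Cycle Γ[H]
    Γ[H]-triangle a∈H = cycle₃ {a = ε , ε-closed} {b = a , a∈H} {c = h , h∈H}
      (λ e → ∈C⇒≢ε a∈C (sym (cong proj₁ e))) (λ e → h≢ε (sym (cong proj₁ e)))
      (a≢h ∘ cong proj₁)
      (subst (ConnII G H C) (sym (ε\\ a)) (a∈H , inj₁ a∈C , ∈C⇒≢ε a∈C))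
      (subst (ConnII G H C) (sym a\\h≡b) (∈H⇒b∈H a∈H , inj₁ b∈C , ∈C⇒≢ε b∈C))
      (\\-closed h∈H ε-closed ,
       inj₂ (b ⁻¹ , a ⁻¹ , C⁻¹⊆C b b∈C , C⁻¹⊆C a a∈C , h\\ε≡b⁻¹a⁻¹) ,
       h≢ε ∘ \\≡ε⇒≡)
      where
      h\\ε≡b⁻¹a⁻¹ : h \\ ε ≡ b ⁻¹ ∙ a ⁻¹
      h\\ε≡b⁻¹a⁻¹ = trans (identityʳ (h ⁻¹)) (trans (cong _⁻¹ h≡ab) (⁻¹-anti-homo-∙ a b))

    Γ[H]-powerCycle : h ∙ h ≢ ε → Cycle Γ[H]
    Γ[H]-powerCycle h²≢ε =
      Cay-powerCycle (ConnII G H C) h∈H (h∈H , inj₂ (a , b , a∈C , b∈C , h≡ab) , h≢ε) h≢ε h²≢ε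

  Γ-forest⇒H∩C²-trivial : Forest Γ → H∩C²-trivial
  Γ-forest⇒H∩C²-trivial forest h h∈H (a , b , a∈C , b∈C , h≡ab) with h ≟ ε
  ... | yes h≡ε = h≡ε
  ... | no h≢ε = ⊥-elim (forest cycle)
    where
    open NontrivialSquare h∈H a∈C b∈C h≡ab h≢ε
    cycle : Cycle Γ
    cycle with T? (H a)
    ... | no a∉H = dihedralCycle (∉H⇒∉⟨h⟩ a∉H)
    ... | yes a∈H with a ∙ a ≟ ε | b ∙ b ≟ ε
    ...   | no a²≢ε  | _        = Γ-powerCycle a∈H a∈C a²≢ε
    ...   | yes _    | no b²≢ε  = Γ-powerCycle (∈H⇒b∈H a∈H) b∈C b²≢ε
    ...   | yes a²≡ε | yes b²≡ε = dihedralCycle (subst (a ∉⟨_⟩) (sym h≡ab)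
      (involutions⇒∉⟨∙⟩ a²≡ε b²≡ε (∈C⇒≢ε a∈C) (∈C⇒≢ε b∈C)))

  triangleSquareFree⇒H∩C²-trivial : TriangleFree Γ → SquareFree Γ → Forest Γ[H] → H∩C²-trivial
  triangleSquareFree⇒H∩C²-trivial triangleFree squareFree forest h h∈H (a , b , a∈C , b∈C , h≡ab)
    with h ≟ ε
  ... | yes h≡ε = h≡ε
  ... | no h≢ε = ⊥-elim contradiction
    where
    open NontrivialSquare h∈H a∈C b∈C h≡ab h≢ε
    contradiction : ⊥
    contradiction with T? (H a)
    ... | yes a∈H = forest (Γ[H]-triangle a∈H)
    ... | no a∉H with T? (C h)
    ...   | yes h∈C = Γ-triangle a∉H h∈C triangleFree
    ...   | no h∉C with h ∙ h ≟ ε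
    ...     | no h²≢ε  = forest (Γ[H]-powerCycle h²≢ε)
    ...     | yes h²≡ε = Γ-square a∉H h∉C h²≡ε squareFree

mainTheorem16 : (G : FiniteGroup) → let open FiniteGroup G in
  (H C : Subset G) →
  IsSubgroup G H → IsProper G H →
  InverseClosed G C → ¬ (_∈_ G ε C) →
  let Γ = RelCayAdj G H C in
  let i = Forest Γ in
  let ii = TriangleFree Γ × SquareFree Γ × Forest (CayAdj G H (ConnII G H C)) in
  let iii = (∀ h → _∈_ G h H → InSquare G C h → h ≡ ε)
            × ((∀ x → ¬ (_∈_ G x H × _∈_ G x C))
               ⊎ Σ Carrier (λ c → IsInvolution G c
                   × (∀ x → (_∈_ G x H × _∈_ G x C) ⇔ (x ≡ c)))) in
  (i ⇔ ii) × (i ⇔ iii)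
mainTheorem16 G H C H≤G _ C⁻¹⊆C ε∉C =
  mk⇔ (λ forest → Forest⇒TriangleFree forest , Forest⇒SquareFree forest ,
                  H∩C²-trivial⇒Γ[H]-forest (Γ-forest⇒H∩C²-trivial forest))
      (λ (triangleFree , squareFree , forest) →
        H∩C²-trivial⇒Γ-forest (triangleSquareFree⇒H∩C²-trivial triangleFree squareFree forest)) ,
  mk⇔ (λ forest → let trivial = Γ-forest⇒H∩C²-trivial forest in
                  trivial , H∩C²-trivial⇒H∩C-emptyOrInvolution trivial)
      (H∩C²-trivial⇒Γ-forest ∘ proj₁)
  where open RelativeCayleyGraph G H C H≤G C⁻¹⊆C ε∉C
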